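{- Let $U=\{u_1,\dots,u_{3n}\}$ and $\mathcal{S}=\{S_1,\dots,S_p\}$ be a family of $3$-element subsets of $U$, with $n,p\ge1$, and let $m\ge 6n+3p$ be an integer. Let $G$ be the labeled complete bipartite graph with partite sets $V_1,V_2$ and tolerances $t$ on $V_1$ constructed as in the context. Then $G$ has a one-sided $t$-perfect clustering if and only if there is a subfamily $\mathcal{S}'\subseteq\mathcal{S}$ such that each $u_i\in U$ lies in exactly one member of $\mathcal{S}'$.
   Context: Construction: For each $u_i\in U$ there are ground vertices $x_i\in V_1$, $y_i\in V_2$; the edge $x_iy_j$ is $+$ if $i=j$ or $u_i,u_j$ lie in a common set of $\mathcal{S}$, and $-$ otherwise. For each $S_i\in\mathcal{S}$ there are triplet vertices $x(S_i)\in V_1$ and $y_1(S_i),\dots,y_m(S_i)\in V_2$; edges $x(S_i)y_k(S_i)$ are $+$, and edges $x(S_i)y_k(S_\ell)$ with $i\ne\ell$ are $-$. For $u_i\in U$ and $S_j\in\mathcal{S}$, the edges $x_iy_k(S_j)$ (all $k$) and $y_ix(S_j)$ are $+$ if $u_i\in S_j$ and $-$ otherwise. There are dummy vertices $Z=\{z_1,\dots,z_{3n}\}\subseteq V_2$, joined by $+$ edges to all $x_i$ and by $-$ edges to all $x(S_j)$. Tolerances: $t_{x(S_i)}=3$; for $u_i\in U$, with $d(u_i)$ the number of sets of $\mathcal{S}$ containing $u_i$ and $c(u_i)$ the number of $u_j\ne u_i$ lying in a common set of $\mathcal{S}$ with $u_i$, $t_{x_i}=m(d(u_i)-1)+(c(u_i)-2)+(|Z|-3)$.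 A clustering is a partition of $V_1\cup V_2$; an error is a $+$ edge between clusters or a $-$ edge within a cluster; a clustering is one-sided $t$-perfect if every $v\in V_1$ is incident to at most $t_v$ errors. -}

module Defs where

open import Data.Nat using (ℕ; suc; _+_; _*_)
open import Data.Integer as ℤ using (ℤ; +_)
open import Data.Fin using (Fin; _≟_)
open import Data.Fin.Subset using (Subset; _∈_)
open import Data.Fin.Subset.Properties using (_∈?_)
open import Data.Bool using (Bool; true; false; _∧_; _∨_; not)
open import Data.List using (List; []; _∷_; map; _++_; concatMap; allFin)
open import Data.Bool.ListAction using (any)
open import Data.Sum using (_⊎_; inj₁; inj₂)
open import Data.Product using (_×_; _,_; Σ; ∃-syntax)
open import Relation.Nullary using (does)
open import Relation.Binary.PropositionalEquality using (_≡_)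

-- U = Fin (3 * n) (u_i ↦ i);  𝒮 = S_1..S_p given as an indexed family of subsets of U.
Family : ℕ → ℕ → Set
Family n p = Fin p → Subset (3 * n)

mem : (n p : ℕ) → Family n p → Fin p → Fin (3 * n) → Bool
mem n p S j i = does (i ∈? S j)

countL : ∀ {A : Set} → (A → Bool) → List A → ℕ
countL f []       = 0
countL f (x ∷ xs) with f x
... | true  = suc (countL f xs)
... | false = countL f xs

share : (n p : ℕ) → Family n p → Fin (3 * n) → Fin (3 * n) → Bool
share n p S i j = any (λ k → mem n p S k i ∧ mem n p S k j) (allFin p)

-- V₁ : x_i (inj₁ i), x(S_j) (inj₂ j)
V₁ : ℕ → ℕ → Set
V₁ n p = Fin (3 * n) ⊎ Fin p

-- V₂ : y_i (inj₁ i), y_k(S_j) (inj₂ (inj₁ (j , k))), z_l (inj₂ (inj₂ l)), Z has 3n elements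
V₂ : ℕ → ℕ → ℕ → Set
V₂ n p m = Fin (3 * n) ⊎ ((Fin p × Fin m) ⊎ Fin (3 * n))

Vertex : ℕ → ℕ → ℕ → Set
Vertex n p m = V₁ n p ⊎ V₂ n p m

-- enumeration of V₂ (each vertex exactly once)
V₂-list : (n p m : ℕ) → List (V₂ n p m)
V₂-list n p m =
  map inj₁ (allFin (3 * n))
  ++ map (λ jk → inj₂ (inj₁ jk)) (concatMap (λ j → map (λ k → (j , k)) (allFin m)) (allFin p))
  ++ map (λ l → inj₂ (inj₂ l)) (allFin (3 * n))

-- sign of the edge between v ∈ V₁ and w ∈ V₂ (true = '+', false = '-')
sign : (n p m : ℕ) → Family n p → V₁ n p → V₂ n p m → Bool
sign n p m S (inj₁ i) (inj₁ j)                = does (i ≟ j) ∨ share n p S i j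
sign n p m S (inj₁ i) (inj₂ (inj₁ (j , k)))   = mem n p S j i
sign n p m S (inj₁ i) (inj₂ (inj₂ z))         = true
sign n p m S (inj₂ a) (inj₁ i)                = mem n p S a i
sign n p m S (inj₂ a) (inj₂ (inj₁ (l , k)))   = does (a ≟ l)
sign n p m S (inj₂ a) (inj₂ (inj₂ z))         = false

-- A clustering (partition of V₁ ∪ V₂) is given by a cluster label for each vertex;
-- two vertices are in the same cluster iff their labels agree.
Clustering : ℕ → ℕ → ℕ → Set
Clustering n p m = Vertex n p m → ℕ

isError : Bool → Bool → Bool
isError s same = (s ∧ not same) ∨ (not s ∧ same)

sameCluster : ℕ → ℕ → Bool
sameCluster a b = does (a Data.Nat.≟ b)

-- number of errors incident to v ∈ V₁ (G is complete bipartite)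
errors : (n p m : ℕ) → Family n p → Clustering n p m → V₁ n p → ℕ
errors n p m S cl v =
  countL (λ w → isError (sign n p m S v w) (sameCluster (cl (inj₁ v)) (cl (inj₂ w)))) (V₂-list n p m)

deg : (n p : ℕ) → Family n p → Fin (3 * n) → ℕ
deg n p S i = countL (λ j → mem n p S j i) (allFin p)

co : (n p : ℕ) → Family n p → Fin (3 * n) → ℕ
co n p S i = countL (λ j → not (does (j ≟ i)) ∧ share n p S i j) (allFin (3 * n))

-- tolerances (integers, so that negative values are kept literally)
tol : (n p m : ℕ) → Family n p → V₁ n p → ℤ
tol n p m S (inj₁ i) =
  ((+ m) ℤ.* (+ deg n p S i ℤ.- + 1)) ℤ.+ (+ co n p S i ℤ.- + 2) ℤ.+ (+ (3 * n) ℤ.- + 3)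
tol n p m S (inj₂ a) = + 3

OneSidedPerfect : (n p m : ℕ) → Family n p → Clustering n p m → Set
OneSidedPerfect n p m S cl = (v : V₁ n p) → + errors n p m S cl v ℤ.≤ tol n p m S v

HasOneSidedPerfectClustering : (n p m : ℕ) → Family n p → Set
HasOneSidedPerfectClustering n p m S = Σ (Clustering n p m) (OneSidedPerfect n p m S)

HasExactCover : (n p : ℕ) → Family n p → Set
HasExactCover n p S =
  Σ (Subset p) λ S' → ((i : Fin (3 * n)) →
    ∃[ j ] (j ∈ S' × i ∈ S j × ((j' : Fin p) → j' ∈ S' → i ∈ S j' → j' ≡ j)))

module Submission where

-- Inside the module Construction:
--   * FromCover: an exact cover gives the clustering with one cluster per chosen set S_a
--     (containing x(S_a), all y_k(S_a) and x_i, y_i, z_i for u_i ∈ S_a); block-by-block counting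
--     shows that every vertex of V₁ stays within its tolerance.
--   * ToCover: in a perfect clustering with m ≥ 6n + 3p, distinct triplet vertices are in distinct
--     clusters, every x_i shares its cluster with x(S_l) for some S_l ∋ u_i, and that cluster then
--     contains y_j for all u_j ∈ S_l.  Hence the sets S_l whose x(S_l) is joined by the ground vertex
--     of an element form an exact cover.
-- The theorem combines the two directions.

open import Defs
open import Data.Nat using (ℕ; _+_; _*_; _≤_)
open import Data.Fin.Subset using (∣_∣)
open import Function.Definitions using (Injective)
open import Function.Bundles using (_⇔_)
open import Relation.Binary.PropositionalEquality using (_≡_)

open import Data.Nat using (zero; suc; z≤n; s≤s)
import Data.Nat as ℕ
open import Data.Nat.Properties
  using ( ≤-refl; ≤-reflexive; ≤-trans; module ≤-Reasoning; m≤m+n; m≤n+m; m+1+n≰m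
        ; +-assoc; +-identityʳ; +-mono-≤; +-monoˡ-≤; +-monoʳ-≤; +-cancelʳ-≤
        ; *-comm; *-zeroʳ; *-identityʳ; *-distribˡ-+; *-monoʳ-≤ )
open import Data.Nat.Tactic.RingSolver using (solve-∀)
open import Data.Integer as ℤ using (ℤ)
import Data.Integer.Properties as ℤ
open import Data.Integer.Solver using (module +-*-Solver)
open import Data.Bool using (Bool; true; false; _∧_; _∨_; not; _xor_)
open import Data.Bool.Properties using (T-≡; ∨-zeroʳ) renaming (_≟_ to _≟ᵇ_)
open import Data.Sum using (inj₁; inj₂)
open import Data.Product using (_×_; _,_; ∃; proj₁; proj₂)
open import Data.Empty using (⊥; ⊥-elim)
open import Data.Fin using (Fin; zero; suc; toℕ; _≟_)
open import Data.Fin.Properties using (toℕ-injective; any?)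
open import Data.Fin.Subset using (Subset; _∈_; inside; outside)
open import Data.Fin.Subset.Properties using (_∈?_)
open import Data.List using (List; []; _∷_; map; _++_; concatMap; allFin; length)
open import Data.List.Properties using (length-tabulate; map-tabulate)
open import Data.List.Membership.Propositional using (lose) renaming (_∈_ to _∈ₗ_)
open import Data.List.Membership.Propositional.Properties using (∈-allFin)
open import Data.List.Relation.Unary.Any using (here; there)
open import Data.List.Relation.Unary.Any.Properties using (any⁺)
open import Data.Vec using ([]; _∷_)
import Data.Vec as Vec
open import Data.Vec.Properties using (lookup∘tabulate; []=⇒lookup; lookup⇒[]=)
open import Function using (_∘_)
open import Function.Bundles using (Equivalence; mk⇔)
open import Relation.Nullary using (Dec; yes; no; does)
open import Relation.Nullary.Decidable using (dec-true; dec-false; _×-dec_)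
open import Relation.Binary.PropositionalEquality
  using (_≢_; refl; sym; trans; cong; cong₂; subst; subst₂; module ≡-Reasoning)

⟦_⟧ : Bool → ℕ
⟦ true  ⟧ = 1
⟦ false ⟧ = 0

∑ : {A : Set} → List A → (A → ℕ) → ℕ
∑ []       f = 0
∑ (x ∷ xs) f = f x + ∑ xs f

infix 8 ∑
syntax ∑ xs (λ x → e) = ∑[ x ← xs ] e

module _ {A : Set} where

  count-as-∑ : (f : A → Bool) (xs : List A) → countL f xs ≡ ∑[ x ← xs ] ⟦ f x ⟧
  count-as-∑ f []       = refl
  count-as-∑ f (x ∷ xs) with f x
  ... | true  = cong suc (count-as-∑ f xs)
  ... | false = count-as-∑ f xs

  ∑-++ : (f : A → ℕ) (xs ys : List A) → ∑ (xs ++ ys) f ≡ ∑ xs f + ∑ ys f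
  ∑-++ f []       ys = refl
  ∑-++ f (x ∷ xs) ys = trans (cong (f x +_) (∑-++ f xs ys)) (sym (+-assoc (f x) _ _))

  ∑-cong : {f g : A → ℕ} → (∀ x → f x ≡ g x) → (xs : List A) → ∑ xs f ≡ ∑ xs g
  ∑-cong f≡g []       = refl
  ∑-cong f≡g (x ∷ xs) = cong₂ _+_ (f≡g x) (∑-cong f≡g xs)

  ∑-mono : {f g : A → ℕ} → (∀ x → f x ≤ g x) → (xs : List A) → ∑ xs f ≤ ∑ xs g
  ∑-mono f≤g []       = z≤n
  ∑-mono f≤g (x ∷ xs) = +-mono-≤ (f≤g x) (∑-mono f≤g xs)

  ∑-zero : {f : A → ℕ} → (∀ x → f x ≡ 0) → (xs : List A) → ∑ xs f ≡ 0
  ∑-zero f≡0 []       = refl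
  ∑-zero f≡0 (x ∷ xs) = cong₂ _+_ (f≡0 x) (∑-zero f≡0 xs)

  ∑-+ : (f g : A → ℕ) (xs : List A) → ∑[ x ← xs ] (f x + g x) ≡ ∑ xs f + ∑ xs g
  ∑-+ f g []       = refl
  ∑-+ f g (x ∷ xs) = trans (cong (f x + g x +_) (∑-+ f g xs)) (interchange (f x) (g x) _ _)
    where
    interchange : ∀ a b c d → a + b + (c + d) ≡ a + c + (b + d)
    interchange = solve-∀

  ∑-*ˡ : (c : ℕ) (f : A → ℕ) (xs : List A) → ∑[ x ← xs ] (c * f x) ≡ c * ∑ xs f
  ∑-*ˡ c f []       = sym (*-zeroʳ c)
  ∑-*ˡ c f (x ∷ xs) = trans (cong (c * f x +_) (∑-*ˡ c f xs)) (sym (*-distribˡ-+ c (f x) _))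

  ∑-const : (c : ℕ) (xs : List A) → ∑[ _ ← xs ] c ≡ length xs * c
  ∑-const c []       = refl
  ∑-const c (x ∷ xs) = cong (c +_) (∑-const c xs)

  term≤∑ : (f : A → ℕ) {x : A} {xs : List A} → x ∈ₗ xs → f x ≤ ∑ xs f
  term≤∑ f {xs = y ∷ ys} (here refl) = m≤m+n (f y) _
  term≤∑ f {xs = y ∷ ys} (there x∈)  = ≤-trans (term≤∑ f x∈) (m≤n+m _ (f y))

∑-map : {A B : Set} (f : B → ℕ) (g : A → B) (xs : List A) → ∑ (map g xs) f ≡ ∑[ x ← xs ] f (g x)
∑-map f g []       = refl
∑-map f g (x ∷ xs) = cong (f (g x) +_) (∑-map f g xs)

∑-concatMap : {A B : Set} (f : B → ℕ) (h : A → List B) (xs : List A) →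
  ∑ (concatMap h xs) f ≡ ∑[ x ← xs ] ∑ (h x) f
∑-concatMap f h []       = refl
∑-concatMap f h (x ∷ xs) = trans (∑-++ f (h x) (concatMap h xs)) (cong (∑ (h x) f +_) (∑-concatMap f h xs))

∑-allFin-const : (k c : ℕ) → ∑[ _ ← allFin k ] c ≡ k * c
∑-allFin-const k c = trans (∑-const c (allFin k)) (cong (_* c) (length-tabulate {n = k} (λ (i : Fin k) → i)))

∑-allFin-suc : {k : ℕ} (f : Fin (suc k) → ℕ) → ∑ (allFin (suc k)) f ≡ f zero + ∑[ j ← allFin k ] f (suc j)
∑-allFin-suc {k} f = cong (f zero +_) (trans
  (cong (λ ys → ∑ ys f) (sym (map-tabulate (λ i → i) suc)))
  (∑-map f suc (allFin k)))

∑-≟ : {k : ℕ} (i : Fin k) → ∑[ j ← allFin k ] ⟦ does (j ≟ i) ⟧ ≡ 1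
∑-≟ {suc k} zero    = trans (∑-allFin-suc {k} (λ j → ⟦ does (j ≟ zero) ⟧))
  (cong suc (∑-zero {f = λ j → ⟦ does (suc j ≟ zero) ⟧} (λ _ → refl) (allFin k)))
∑-≟ {suc k} (suc i) = trans (∑-allFin-suc {k} (λ j → ⟦ does (j ≟ suc i) ⟧)) (∑-≟ i)

∑-∈ : {k : ℕ} (q : Subset k) → ∑[ i ← allFin k ] ⟦ does (i ∈? q) ⟧ ≡ ∣ q ∣
∑-∈ {zero}  []            = refl
∑-∈ {suc k} (inside  ∷ q) = trans (∑-allFin-suc {k} (λ i → ⟦ does (i ∈? (inside ∷ q)) ⟧)) (cong suc (∑-∈ q))
∑-∈ {suc k} (outside ∷ q) = trans (∑-allFin-suc {k} (λ i → ⟦ does (i ∈? (outside ∷ q)) ⟧)) (∑-∈ q)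

does⇒ : {P : Set} (d : Dec P) → does d ≡ true → P
does⇒ (yes p) _ = p

sameCluster⇒≡ : ∀ {a b} → sameCluster a b ≡ true → a ≡ b
sameCluster⇒≡ {a} {b} = does⇒ (a ℕ.≟ b)

≟-sym : {k : ℕ} (a b : Fin k) → does (a ≟ b) ≡ does (b ≟ a)
≟-sym a b with a ≟ b | b ≟ a
... | yes _   | yes _   = refl
... | no _    | no _    = refl
... | yes a≡b | no b≢a  = ⊥-elim (b≢a (sym a≡b))
... | no a≢b  | yes b≡a = ⊥-elim (a≢b (sym b≡a))

sameCluster-toℕ : {k : ℕ} (a b : Fin k) → sameCluster (toℕ a) (toℕ b) ≡ does (a ≟ b)
sameCluster-toℕ a b with a ≟ b
... | yes refl = dec-true (toℕ a ℕ.≟ toℕ a) refl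
... | no a≢b   = dec-false (toℕ a ℕ.≟ toℕ b) (a≢b ∘ toℕ-injective)

Err : Bool → Bool → ℕ
Err s b = ⟦ isError s b ⟧

Err≤1 : ∀ s b → Err s b ≤ 1
Err≤1 true  true  = z≤n
Err≤1 true  false = ≤-refl
Err≤1 false true  = ≤-refl
Err≤1 false false = z≤n

Err-outside : ∀ s → Err s false ≡ ⟦ s ⟧
Err-outside true  = refl
Err-outside false = refl

-- Two vertices in one cluster whose edges to w have different signs see an error at w.
Err-disagree : ∀ s s' b → ⟦ s xor s' ⟧ ≤ Err s b + Err s' b
Err-disagree true  true  b     = z≤n
Err-disagree true  false true  = ≤-refl
Err-disagree true  false false = ≤-refl
Err-disagree false true  true  = ≤-refl
Err-disagree false true  false = ≤-refl
Err-disagree false false b     = z≤n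

⟦⟧≤ : ∀ b {a} → (b ≡ true → 1 ≤ a) → ⟦ b ⟧ ≤ a
⟦⟧≤ true  positive = positive refl
⟦⟧≤ false positive = z≤n

∧-not≤xor : ∀ s u → ⟦ s ∧ not u ⟧ ≤ ⟦ s xor u ⟧
∧-not≤xor true  true  = z≤n
∧-not≤xor true  false = ≤-refl
∧-not≤xor false u     = z≤n

-- A vertex w with '+' edges into two different clusters is outside one of them, so one edge errs.
Err-apart : ∀ b b' → (b ≡ true → b' ≡ true → ⊥) → 1 ≤ Err true b + Err true b'
Err-apart true  true  apart = ⊥-elim (apart refl refl)
Err-apart true  false apart = ≤-refl
Err-apart false b'    apart = s≤s z≤n

within-tolerance : ∀ m d c N E →
  (ℤ.+ E ℤ.≤ ℤ.+ m ℤ.* (ℤ.+ d ℤ.- ℤ.+ 1) ℤ.+ (ℤ.+ c ℤ.- ℤ.+ 2) ℤ.+ (ℤ.+ N ℤ.- ℤ.+ 3))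
    ⇔ (E + (m + 5) ≤ m * d + c + N)
within-tolerance m d c N E = mk⇔
  (λ E≤t → ℤ.drop‿+≤+ (subst₂ ℤ._≤_ (sym (ℤ.pos-+ E (m + 5))) shift (ℤ.+-monoˡ-≤ (ℤ.+ (m + 5)) E≤t)))
  (λ E≤ → cancelʳ (ℤ.+ (m + 5)) (subst₂ ℤ._≤_ (ℤ.pos-+ E (m + 5)) (sym shift) (ℤ.+≤+ E≤)))
  where
  open +-*-Solver
  t : ℤ
  t = ℤ.+ m ℤ.* (ℤ.+ d ℤ.- ℤ.+ 1) ℤ.+ (ℤ.+ c ℤ.- ℤ.+ 2) ℤ.+ (ℤ.+ N ℤ.- ℤ.+ 3)
  shift : t ℤ.+ ℤ.+ (m + 5) ≡ ℤ.+ (m * d + c + N)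
  shift = begin
    t ℤ.+ ℤ.+ (m + 5)                   ≡⟨ cong (λ k → t ℤ.+ k) (ℤ.pos-+ m 5) ⟩
    t ℤ.+ (ℤ.+ m ℤ.+ ℤ.+ 5)             ≡⟨ solve 4 (λ m d c N →
      m :* (d :- con (ℤ.+ 1)) :+ (c :- con (ℤ.+ 2)) :+ (N :- con (ℤ.+ 3)) :+ (m :+ con (ℤ.+ 5))
        := m :* d :+ c :+ N) refl (ℤ.+ m) (ℤ.+ d) (ℤ.+ c) (ℤ.+ N) ⟩
    ℤ.+ m ℤ.* ℤ.+ d ℤ.+ ℤ.+ c ℤ.+ ℤ.+ N ≡⟨ cong (λ k → k ℤ.+ ℤ.+ c ℤ.+ ℤ.+ N) (ℤ.pos-* m d) ⟨
    ℤ.+ (m * d) ℤ.+ ℤ.+ c ℤ.+ ℤ.+ N     ≡⟨ cong (λ k → k ℤ.+ ℤ.+ N) (ℤ.pos-+ (m * d) c) ⟨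
    ℤ.+ (m * d + c) ℤ.+ ℤ.+ N           ≡⟨ ℤ.pos-+ (m * d + c) N ⟨
    ℤ.+ (m * d + c + N)                 ∎
    where open ≡-Reasoning
  cancelʳ : ∀ k {i j} → i ℤ.+ k ℤ.≤ j ℤ.+ k → i ℤ.≤ j
  cancelʳ k {i} {j} le = subst₂ ℤ._≤_ (cancel i) (cancel j) (ℤ.+-monoˡ-≤ (ℤ.- k) le)
    where
    cancel : ∀ a → a ℤ.+ k ℤ.- k ≡ a
    cancel a = solve 2 (λ a k → a :+ k :- k := a) refl a k

module Construction (n p m : ℕ) (S : Family n p) (triples : ∀ l → ∣ S l ∣ ≡ 3) where

  N : ℕ
  N = 3 * n

  inS : Fin p → Fin N → Bool
  inS = mem n p S

  inS⇒∈ : ∀ {l i} → inS l i ≡ true → i ∈ S l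
  inS⇒∈ {l} {i} = does⇒ (i ∈? S l)

  ∈⇒inS : ∀ {l i} → i ∈ S l → inS l i ≡ true
  ∈⇒inS {l} {i} = dec-true (i ∈? S l)

  ∑-inS : ∀ l → ∑[ j ← allFin N ] ⟦ inS l j ⟧ ≡ 3
  ∑-inS l = trans (∑-∈ (S l)) (triples l)

  share-intro : ∀ l i j → inS l i ≡ true → inS l j ≡ true → share n p S i j ≡ true
  share-intro l i j i∈ j∈ = T⇒≡ (any⁺ (λ k → inS k i ∧ inS k j) (lose (∈-allFin l) (≡⇒T (cong₂ _∧_ i∈ j∈))))
    where
    T⇒≡ = Equivalence.to T-≡
    ≡⇒T = Equivalence.from T-≡

  deg-as-∑ : ∀ i → deg n p S i ≡ ∑[ l ← allFin p ] ⟦ inS l i ⟧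
  deg-as-∑ i = count-as-∑ (λ l → inS l i) (allFin p)

  co-as-∑ : ∀ i → co n p S i + 1 ≡ ∑[ j ← allFin N ] (⟦ not (does (j ≟ i)) ∧ share n p S i j ⟧ + ⟦ does (j ≟ i) ⟧)
  co-as-∑ i = begin
    co n p S i + 1  ≡⟨ cong₂ _+_ (count-as-∑ _ (allFin N)) (sym (∑-≟ i)) ⟩
    _               ≡⟨ ∑-+ _ _ (allFin N) ⟨
    _               ∎
    where open ≡-Reasoning

  co<N : ∀ i → co n p S i + 1 ≤ N
  co<N i = begin
    co n p S i + 1  ≡⟨ co-as-∑ i ⟩
    _               ≤⟨ ∑-mono (λ j → at-most-one (does (j ≟ i)) _) (allFin N) ⟩
    ∑[ _ ← allFin N ] 1 ≡⟨ ∑-allFin-const N 1 ⟩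
    N * 1           ≡⟨ *-identityʳ N ⟩
    N               ∎
    where
    open ≤-Reasoning
    at-most-one : ∀ d sh → ⟦ not d ∧ sh ⟧ + ⟦ d ⟧ ≤ 1
    at-most-one true  sh    = ≤-refl
    at-most-one false true  = ≤-refl
    at-most-one false false = z≤n

  x : Fin N → V₁ n p
  x = inj₁
  xS : Fin p → V₁ n p
  xS = inj₂
  y : Fin N → V₂ n p m
  y = inj₁
  yS : Fin p → Fin m → V₂ n p m
  yS l k = inj₂ (inj₁ (l , k))
  z : Fin N → V₂ n p m
  z i = inj₂ (inj₂ i)

  ∑y ∑yS ∑z : (V₂ n p m → ℕ) → ℕ
  ∑y f  = ∑[ j ← allFin N ] f (y j)
  ∑yS f = ∑[ l ← allFin p ] ∑[ k ← allFin m ] f (yS l k)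
  ∑z f  = ∑[ j ← allFin N ] f (z j)

  ∑V₂-split : (f : V₂ n p m → ℕ) → ∑ (V₂-list n p m) f ≡ ∑y f + (∑yS f + ∑z f)
  ∑V₂-split f = begin
    ∑ (V₂-list n p m) f
      ≡⟨ ∑-++ f (map y (allFin N)) (map (λ lk → inj₂ (inj₁ lk)) pairs ++ map z (allFin N)) ⟩
    ∑ (map y (allFin N)) f + ∑ (map (λ lk → inj₂ (inj₁ lk)) pairs ++ map z (allFin N)) f
      ≡⟨ cong₂ _+_ (∑-map f y (allFin N)) (∑-++ f (map (λ lk → inj₂ (inj₁ lk)) pairs) (map z (allFin N))) ⟩
    ∑y f + (∑ (map (λ lk → inj₂ (inj₁ lk)) pairs) f + ∑ (map z (allFin N)) f)
      ≡⟨ cong (λ s → ∑y f + s) (cong₂ _+_ pairs-block (∑-map f z (allFin N))) ⟩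
    ∑y f + (∑yS f + ∑z f) ∎
    where
    open ≡-Reasoning
    row : Fin p → List (Fin p × Fin m)
    row l = map (λ k → (l , k)) (allFin m)
    pairs : List (Fin p × Fin m)
    pairs = concatMap row (allFin p)
    pairs-block : ∑ (map (λ lk → inj₂ (inj₁ lk)) pairs) f ≡ ∑yS f
    pairs-block = begin
      ∑ (map (λ lk → inj₂ (inj₁ lk)) pairs) f      ≡⟨ ∑-map f (λ lk → inj₂ (inj₁ lk)) pairs ⟩
      ∑[ lk ← pairs ] f (inj₂ (inj₁ lk))            ≡⟨ ∑-concatMap (λ lk → f (inj₂ (inj₁ lk))) row (allFin p) ⟩
      ∑[ l ← allFin p ] ∑ (row l) (λ lk → f (inj₂ (inj₁ lk)))
        ≡⟨ ∑-cong (λ l → ∑-map (λ lk → f (inj₂ (inj₁ lk))) (λ k → (l , k)) (allFin m)) (allFin p) ⟩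
      ∑yS f ∎

  module ErrorsOf (cl : Clustering n p m) where

    err : V₁ n p → V₂ n p m → ℕ
    err v w = Err (sign n p m S v w) (sameCluster (cl (inj₁ v)) (cl (inj₂ w)))

    errors-split : ∀ v → errors n p m S cl v ≡ ∑y (err v) + (∑yS (err v) + ∑z (err v))
    errors-split v = trans (count-as-∑ _ (V₂-list n p m)) (∑V₂-split (err v))

    errors-pair : ∀ v v' → errors n p m S cl v + errors n p m S cl v' ≡
      ∑y (λ w → err v w + err v' w) + (∑yS (λ w → err v w + err v' w) + ∑z (λ w → err v w + err v' w))
    errors-pair v v' = begin
      errors n p m S cl v + errors n p m S cl v'
        ≡⟨ cong₂ _+_ (count-as-∑ _ (V₂-list n p m)) (count-as-∑ _ (V₂-list n p m)) ⟩
      ∑ (V₂-list n p m) (err v) + ∑ (V₂-list n p m) (err v')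
        ≡⟨ ∑-+ (err v) (err v') (V₂-list n p m) ⟨
      ∑[ w ← V₂-list n p m ] (err v w + err v' w)
        ≡⟨ ∑V₂-split (λ w → err v w + err v' w) ⟩
      _ ∎
      where open ≡-Reasoning

    errors-yS≤ : ∀ v → ∑yS (err v) ≤ errors n p m S cl v
    errors-yS≤ v = begin
      ∑yS (err v)                        ≤⟨ m≤m+n (∑yS (err v)) _ ⟩
      ∑yS (err v) + ∑z (err v)           ≤⟨ m≤n+m _ (∑y (err v)) ⟩
      ∑y (err v) + (∑yS (err v) + ∑z (err v)) ≡⟨ errors-split v ⟨
      errors n p m S cl v                ∎
      where open ≤-Reasoning

    errors-row≤ : ∀ v l → ∑[ k ← allFin m ] err v (yS l k) ≤ errors n p m S cl v
    errors-row≤ v l = ≤-trans (term≤∑ (λ l → ∑[ k ← allFin m ] err v (yS l k)) (∈-allFin l)) (errors-yS≤ v)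

  -- An exact cover, presented as the map sending each element to the chosen set containing it.
  record CoverMap : Set where
    field
      block  : Fin N → Fin p
      covers : ∀ i → inS (block i) i ≡ true
      closed : ∀ i j → inS (block i) j ≡ true → block j ≡ block i

  coverMap : HasExactCover n p S → CoverMap
  coverMap (_ , cover) = record
    { block  = block
    ; covers = λ i → ∈⇒inS (proj₁ (proj₂ (proj₂ (cover i))))
    ; closed = λ i j j∈ → sym (proj₂ (proj₂ (proj₂ (cover j))) (block i) (proj₁ (proj₂ (cover i))) (inS⇒∈ j∈))
    }
    where
    block : Fin N → Fin p
    block i = proj₁ (cover i)

  -- From an exact cover: one cluster per chosen set S_a, holding x(S_a), every y_k(S_a), and
  -- x_i, y_i, z_i for u_i ∈ S_a; the clusters of unchosen sets hold only their triplet vertices.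
  module FromCover (C : CoverMap) where
    open CoverMap C

    label : Vertex n p m → Fin p
    label (inj₁ (inj₁ i))                = block i
    label (inj₁ (inj₂ a))                = a
    label (inj₂ (inj₁ i))                = block i
    label (inj₂ (inj₂ (inj₁ (l , k))))   = l
    label (inj₂ (inj₂ (inj₂ i)))         = block i

    clustering : Clustering n p m
    clustering v = toℕ (label v)

    open ErrorsOf clustering

    err-label : ∀ v w → err v w ≡ Err (sign n p m S v w) (does (label (inj₁ v) ≟ label (inj₂ w)))
    err-label v w = cong (Err (sign n p m S v w)) (sameCluster-toℕ (label (inj₁ v)) (label (inj₂ w)))

    triplet-y-z : ∀ a i → err (xS a) (y i) + err (xS a) (z i) ≤ ⟦ inS a i ⟧
    triplet-y-z a i rewrite err-label (xS a) (y i) | err-label (xS a) (z i) with a ≟ block i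
    ... | yes refl rewrite covers i = ≤-refl
    ... | no _     rewrite Err-outside (inS a i) = ≤-reflexive (+-identityʳ _)

    -- x(S_a) makes no error on any y_k(S_l): the sign is '+' exactly when l = a.
    triplet-yS : ∀ a l k → err (xS a) (yS l k) ≡ 0
    triplet-yS a l k rewrite err-label (xS a) (yS l k) with a ≟ l
    ... | yes _ = refl
    ... | no _  = refl

    triplet-errors : ∀ a → errors n p m S clustering (xS a) ≤ 3
    triplet-errors a = begin
      errors n p m S clustering (xS a)              ≡⟨ errors-split (xS a) ⟩
      ∑y (err (xS a)) + (∑yS (err (xS a)) + ∑z (err (xS a)))
        ≡⟨ cong (λ s → ∑y (err (xS a)) + (s + ∑z (err (xS a))))
             (∑-zero (λ l → ∑-zero (triplet-yS a l) (allFin m)) (allFin p)) ⟩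
      ∑y (err (xS a)) + ∑z (err (xS a))             ≡⟨ ∑-+ _ _ (allFin N) ⟨
      ∑[ i ← allFin N ] (err (xS a) (y i) + err (xS a) (z i)) ≤⟨ ∑-mono (triplet-y-z a) (allFin N) ⟩
      ∑[ i ← allFin N ] ⟦ inS a i ⟧                 ≡⟨ ∑-inS a ⟩
      3                                             ∎
      where open ≤-Reasoning

    -- u_j lies in its own set, so a set missing u_j is not the set of u_j.
    outside-block : ∀ {a j} → inS a j ≡ false → a ≢ block j
    outside-block {j = j} j∉ refl with () ← trans (sym (covers j)) j∉

    -- In the y-block, x_i errs exactly on the y_j with u_j ∉ S_(block i) sharing a set with u_i,
    -- while y_j is in the cluster of x_i for the three u_j ∈ S_(block i).
    ground-y : ∀ i j → err (x i) (y j) + ⟦ inS (block i) j ⟧ ≤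
                       ⟦ not (does (j ≟ i)) ∧ share n p S i j ⟧ + ⟦ does (j ≟ i) ⟧
    ground-y i j rewrite err-label (x i) (y j) | ≟-sym i j with j ≟ i
    ... | yes refl rewrite covers j | dec-true (block j ≟ block j) refl = ≤-refl
    ... | no _ with inS (block i) j in j∈
    ...   | true rewrite closed i j j∈ | dec-true (block i ≟ block i) refl =
      subst (λ s → Err s true + 1 ≤ ⟦ s ⟧ + 0) (sym (share-intro (block i) i j (covers i) j∈)) ≤-refl
    ...   | false rewrite dec-false (block i ≟ block j) (outside-block j∈)
                        | Err-outside (share n p S i j) = ≤-refl

    -- Within the block y(S_l), x_i errs on every vertex when u_i ∈ S_l and S_l is not its own set.
    ground-yS : ∀ i l k → err (x i) (yS l k) + ⟦ does (l ≟ block i) ⟧ ≤ ⟦ inS l i ⟧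
    ground-yS i l k rewrite err-label (x i) (yS l k) with l ≟ block i
    ... | yes refl rewrite covers i | dec-true (block i ≟ block i) refl = ≤-refl
    ... | no l≢a   rewrite dec-false (block i ≟ l) (l≢a ∘ sym) | Err-outside (inS l i) = ≤-reflexive (+-identityʳ _)

    -- x_i errs on z_j unless z_j is in its cluster, which holds for the three u_j ∈ S_(block i).
    ground-z : ∀ i j → err (x i) (z j) + ⟦ inS (block i) j ⟧ ≤ 1
    ground-z i j with inS (block i) j in j∈
    ... | true  rewrite err-label (x i) (z j) | closed i j j∈ | dec-true (block i ≟ block i) refl = ≤-refl
    ... | false = ≤-trans (≤-reflexive (+-identityʳ _)) (Err≤1 true _)

    ground-y-errors : ∀ i → ∑y (err (x i)) + 3 ≤ co n p S i + 1
    ground-y-errors i = begin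
      ∑y (err (x i)) + 3                                      ≡⟨ cong (∑y (err (x i)) +_) (∑-inS (block i)) ⟨
      ∑y (err (x i)) + ∑[ j ← allFin N ] ⟦ inS (block i) j ⟧  ≡⟨ ∑-+ _ _ (allFin N) ⟨
      ∑[ j ← allFin N ] (err (x i) (y j) + ⟦ inS (block i) j ⟧) ≤⟨ ∑-mono (ground-y i) (allFin N) ⟩
      _                                                       ≡⟨ co-as-∑ i ⟨
      co n p S i + 1                                          ∎
      where open ≤-Reasoning

    ground-yS-errors : ∀ i → ∑yS (err (x i)) + m ≤ m * deg n p S i
    ground-yS-errors i = begin
      ∑yS (err (x i)) + m
        ≡⟨ cong (∑yS (err (x i)) +_) (trans (∑-*ˡ m _ (allFin p)) (trans (cong (m *_) (∑-≟ (block i))) (*-identityʳ m))) ⟨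
      ∑yS (err (x i)) + ∑[ l ← allFin p ] (m * ⟦ does (l ≟ block i) ⟧)   ≡⟨ ∑-+ _ _ (allFin p) ⟨
      ∑[ l ← allFin p ] (∑[ k ← allFin m ] err (x i) (yS l k) + m * ⟦ does (l ≟ block i) ⟧)
        ≤⟨ ∑-mono row (allFin p) ⟩
      ∑[ l ← allFin p ] (m * ⟦ inS l i ⟧)                                 ≡⟨ ∑-*ˡ m _ (allFin p) ⟩
      m * ∑[ l ← allFin p ] ⟦ inS l i ⟧                                   ≡⟨ cong (m *_) (deg-as-∑ i) ⟨
      m * deg n p S i                                                     ∎
      where
      open ≤-Reasoning
      row : ∀ l → ∑[ k ← allFin m ] err (x i) (yS l k) + m * ⟦ does (l ≟ block i) ⟧ ≤ m * ⟦ inS l i ⟧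
      row l = begin
        ∑[ k ← allFin m ] err (x i) (yS l k) + m * ⟦ does (l ≟ block i) ⟧
          ≡⟨ cong (∑[ k ← allFin m ] err (x i) (yS l k) +_) (∑-allFin-const m _) ⟨
        ∑[ k ← allFin m ] err (x i) (yS l k) + ∑[ _ ← allFin m ] ⟦ does (l ≟ block i) ⟧
          ≡⟨ ∑-+ _ _ (allFin m) ⟨
        ∑[ k ← allFin m ] (err (x i) (yS l k) + ⟦ does (l ≟ block i) ⟧)  ≤⟨ ∑-mono (ground-yS i l) (allFin m) ⟩
        ∑[ _ ← allFin m ] ⟦ inS l i ⟧                                     ≡⟨ ∑-allFin-const m _ ⟩
        m * ⟦ inS l i ⟧                                                   ∎

    ground-z-errors : ∀ i → ∑z (err (x i)) + 3 ≤ N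
    ground-z-errors i = begin
      ∑z (err (x i)) + 3                                      ≡⟨ cong (∑z (err (x i)) +_) (∑-inS (block i)) ⟨
      ∑z (err (x i)) + ∑[ j ← allFin N ] ⟦ inS (block i) j ⟧  ≡⟨ ∑-+ _ _ (allFin N) ⟨
      ∑[ j ← allFin N ] (err (x i) (z j) + ⟦ inS (block i) j ⟧) ≤⟨ ∑-mono (ground-z i) (allFin N) ⟩
      ∑[ _ ← allFin N ] 1                                     ≡⟨ ∑-allFin-const N 1 ⟩
      N * 1                                                   ≡⟨ *-identityʳ N ⟩
      N                                                       ∎
      where open ≤-Reasoning

    ground-errors : ∀ i → errors n p m S clustering (x i) + (m + 5) ≤ m * deg n p S i + co n p S i + N
    ground-errors i = +-cancelʳ-≤ 1 _ _ (begin
      errors n p m S clustering (x i) + (m + 5) + 1  ≡⟨ cong (λ e → e + (m + 5) + 1) (errors-split (x i)) ⟩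
      Y + (K + Z) + (m + 5) + 1                      ≡⟨ regroup Y K Z m ⟩
      (K + m) + (Y + 3) + (Z + 3)
        ≤⟨ +-mono-≤ (+-mono-≤ (ground-yS-errors i) (ground-y-errors i)) (ground-z-errors i) ⟩
      m * deg n p S i + (co n p S i + 1) + N         ≡⟨ move-one (m * deg n p S i) (co n p S i) N ⟩
      m * deg n p S i + co n p S i + N + 1           ∎)
      where
      open ≤-Reasoning
      Y = ∑y (err (x i))
      K = ∑yS (err (x i))
      Z = ∑z (err (x i))
      regroup : ∀ Y K Z m → Y + (K + Z) + (m + 5) + 1 ≡ (K + m) + (Y + 3) + (Z + 3)
      regroup = solve-∀
      move-one : ∀ a c N → a + (c + 1) + N ≡ a + c + N + 1
      move-one = solve-∀

    perfect : OneSidedPerfect n p m S clustering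
    perfect (inj₁ i) = Equivalence.from (within-tolerance m (deg n p S i) (co n p S i) N _) (ground-errors i)
    perfect (inj₂ a) = ℤ.+≤+ (triplet-errors a)

  module ToCover (nine : 9 ≤ m) (large : N + N + 3 * p ≤ m)
                 (cl : Clustering n p m) (perfect : OneSidedPerfect n p m S cl) where
    open ErrorsOf cl

    cx cy : Fin N → ℕ
    cx i = cl (inj₁ (x i))
    cy j = cl (inj₂ (y j))
    cxS : Fin p → ℕ
    cxS l = cl (inj₁ (xS l))

    triplet-errors : ∀ l → errors n p m S cl (xS l) ≤ 3
    triplet-errors l = ℤ.drop‿+≤+ (perfect (xS l))

    ground-errors : ∀ i → errors n p m S cl (x i) + (m + 5) ≤ m * deg n p S i + co n p S i + N
    ground-errors i = Equivalence.to (within-tolerance m (deg n p S i) (co n p S i) N _) (perfect (x i))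

    disagree : ∀ v v' w → cl (inj₁ v) ≡ cl (inj₁ v') → ⟦ sign n p m S v w xor sign n p m S v' w ⟧ ≤ err v w + err v' w
    disagree v v' w same =
      subst (λ c → ⟦ sign n p m S v w xor sign n p m S v' w ⟧ ≤ err v w + Err (sign n p m S v' w) (sameCluster c (cl (inj₂ w))))
            same (Err-disagree (sign n p m S v w) (sign n p m S v' w) (sameCluster (cl (inj₁ v)) (cl (inj₂ w))))

    outside-error : ∀ v w → sign n p m S v w ≡ true → cl (inj₁ v) ≢ cl (inj₂ w) → 1 ≤ err v w
    outside-error v w v+ v≁w = subst (λ s → 1 ≤ Err s (sameCluster (cl (inj₁ v)) (cl (inj₂ w)))) (sym v+)
      (subst (λ b → 1 ≤ Err true b) (sym (dec-false (cl (inj₁ v) ℕ.≟ cl (inj₂ w)) v≁w)) ≤-refl)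

    apart : ∀ v v' w → sign n p m S v w ≡ true → sign n p m S v' w ≡ true →
            cl (inj₁ v) ≢ cl (inj₁ v') → 1 ≤ err v w + err v' w
    apart v v' w v+ v'+ v≁v' = subst₂ (λ s s' → 1 ≤ Err s b + Err s' b') (sym v+) (sym v'+)
      (Err-apart b b' (λ b≡t b'≡t → v≁v' (trans (sameCluster⇒≡ b≡t) (sym (sameCluster⇒≡ b'≡t)))))
      where
      b  = sameCluster (cl (inj₁ v)) (cl (inj₂ w))
      b' = sameCluster (cl (inj₁ v')) (cl (inj₂ w))

    -- Distinct triplet vertices lie in distinct clusters: otherwise the m vertices y_k(S_l) would
    -- each cause an error at x(S_l) or x(S_l'), which tolerate only 3 + 3 < m errors.
    triplets-separated : ∀ l l' → cxS l ≡ cxS l' → l ≡ l'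
    triplets-separated l l' same with l ≟ l'
    ... | yes l≡l' = l≡l'
    ... | no  l≢l' = ⊥-elim (m+1+n≰m 6 (≤-trans nine (begin
      m                                                          ≡⟨ trans (∑-allFin-const m 1) (*-identityʳ m) ⟨
      ∑[ _ ← allFin m ] 1                                        ≤⟨ ∑-mono conflict (allFin m) ⟩
      ∑[ k ← allFin m ] (err (xS l) (yS l k) + err (xS l') (yS l k)) ≡⟨ ∑-+ _ _ (allFin m) ⟩
      ∑[ k ← allFin m ] err (xS l) (yS l k) + ∑[ k ← allFin m ] err (xS l') (yS l k)
        ≤⟨ +-mono-≤ (≤-trans (errors-row≤ (xS l) l) (triplet-errors l)) (≤-trans (errors-row≤ (xS l') l) (triplet-errors l')) ⟩
      6                                                          ∎)))
      where
      open ≤-Reasoning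
      signs-differ : ⟦ does (l ≟ l) xor does (l' ≟ l) ⟧ ≡ 1
      signs-differ rewrite dec-true (l ≟ l) refl | dec-false (l' ≟ l) (l≢l' ∘ sym) = refl
      conflict : ∀ k → 1 ≤ err (xS l) (yS l k) + err (xS l') (yS l k)
      conflict k = subst (_≤ err (xS l) (yS l k) + err (xS l') (yS l k)) signs-differ (disagree (xS l) (xS l') (yS l k) same)

    JoinsOwnSet : Fin N → Fin p → Set
    JoinsOwnSet i l = (inS l i ≡ true) × (cxS l ≡ cx i)

    joins? : ∀ i l → Dec (JoinsOwnSet i l)
    joins? i l = (inS l i ≟ᵇ true) ×-dec (cxS l ℕ.≟ cx i)

    -- Otherwise every y_k(S_l) with u_i ∈ S_l errs at x_i
    -- or at x(S_l), costing x_i at least m·d(u_i) - 3p errors, more than its tolerance allows once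
    -- m ≥ 2N + 3p.
    ground-joins : ∀ i → ∃ (JoinsOwnSet i)
    ground-joins i with any? (joins? i)
    ... | yes found = found
    ... | no  none  = ⊥-elim (m+1+n≰m (E + m) (begin
      E + m + 6                                     ≡⟨ six E m ⟨
      E + (m + 5) + 1                               ≤⟨ +-monoˡ-≤ 1 (ground-errors i) ⟩
      m * deg n p S i + co n p S i + N + 1           ≤⟨ +-monoˡ-≤ 1 (+-monoˡ-≤ N (+-monoˡ-≤ (co n p S i) deg-cost)) ⟩
      (E + 3 * p) + co n p S i + N + 1               ≡⟨ move-one (E + 3 * p) (co n p S i) N ⟩
      (E + 3 * p) + (co n p S i + 1) + N             ≤⟨ +-monoˡ-≤ N (+-monoʳ-≤ (E + 3 * p) (co<N i)) ⟩
      (E + 3 * p) + N + N                            ≡⟨ regroup E (3 * p) N ⟩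
      E + (N + N + 3 * p)                            ≤⟨ +-monoʳ-≤ E large ⟩
      E + m                                          ∎))
      where
      open ≤-Reasoning
      E = errors n p m S cl (x i)
      six : ∀ E m → E + (m + 5) + 1 ≡ E + m + 6
      six = solve-∀
      move-one : ∀ a c N → a + c + N + 1 ≡ a + (c + 1) + N
      move-one = solve-∀
      regroup : ∀ E q N → E + q + N + N ≡ E + (N + N + q)
      regroup = solve-∀
      Q = ∑[ l ← allFin p ] ∑[ k ← allFin m ] err (xS l) (yS l k)
      miss : ∀ l k → ⟦ inS l i ⟧ ≤ err (x i) (yS l k) + err (xS l) (yS l k)
      miss l k = ⟦⟧≤ (inS l i) λ i∈ → apart (x i) (xS l) (yS l k) i∈ (dec-true (l ≟ l) refl) (λ e → none (l , i∈ , sym e))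
      Q≤3p : Q ≤ 3 * p
      Q≤3p = begin
        Q                      ≤⟨ ∑-mono (λ l → ≤-trans (errors-row≤ (xS l) l) (triplet-errors l)) (allFin p) ⟩
        ∑[ _ ← allFin p ] 3    ≡⟨ ∑-allFin-const p 3 ⟩
        p * 3                  ≡⟨ *-comm p 3 ⟩
        3 * p                  ∎
      deg-cost : m * deg n p S i ≤ E + 3 * p
      deg-cost = begin
        m * deg n p S i                                         ≡⟨ cong (m *_) (deg-as-∑ i) ⟩
        m * ∑[ l ← allFin p ] ⟦ inS l i ⟧                       ≡⟨ ∑-*ˡ m _ (allFin p) ⟨
        ∑[ l ← allFin p ] (m * ⟦ inS l i ⟧)                     ≡⟨ ∑-cong (λ l → ∑-allFin-const m _) (allFin p) ⟨
        ∑[ l ← allFin p ] ∑[ _ ← allFin m ] ⟦ inS l i ⟧         ≤⟨ ∑-mono (λ l → ∑-mono (miss l) (allFin m)) (allFin p) ⟩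
        ∑[ l ← allFin p ] ∑[ k ← allFin m ] (err (x i) (yS l k) + err (xS l) (yS l k))
          ≡⟨ trans (∑-cong (λ l → ∑-+ _ _ (allFin m)) (allFin p)) (∑-+ _ _ (allFin p)) ⟩
        ∑yS (err (x i)) + Q                                     ≤⟨ +-mono-≤ (errors-yS≤ (x i)) Q≤3p ⟩
        E + 3 * p                                               ∎

    module Joined (i : Fin N) (l : Fin p) (i∈ : inS l i ≡ true) (joined : cxS l ≡ cx i) where

      outsider : Fin N → Bool
      outsider j = not (inS l j) ∧ (not (does (j ≟ i)) ∧ share n p S i j)

      outsiders : ℕ
      outsiders = ∑[ j ← allFin N ] ⟦ outsider j ⟧

      other : Fin p → Bool
      other l' = inS l' i ∧ not (does (l' ≟ l))

      others : ℕ
      others = ∑[ l' ← allFin p ] ⟦ other l' ⟧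

      deg≤ : m * deg n p S i ≤ m * others + m
      deg≤ = begin
        m * deg n p S i                                     ≡⟨ cong (m *_) (deg-as-∑ i) ⟩
        m * ∑[ l' ← allFin p ] ⟦ inS l' i ⟧
          ≤⟨ *-monoʳ-≤ m (∑-mono (λ l' → split-off (inS l' i) (does (l' ≟ l))) (allFin p)) ⟩
        m * ∑[ l' ← allFin p ] (⟦ other l' ⟧ + ⟦ does (l' ≟ l) ⟧)
          ≡⟨ cong (m *_) (trans (∑-+ _ _ (allFin p)) (cong (others +_) (∑-≟ l))) ⟩
        m * (others + 1)                                    ≡⟨ *-distribˡ-+ m others 1 ⟩
        m * others + m * 1                                  ≡⟨ cong (m * others +_) (*-identityʳ m) ⟩
        m * others + m                                      ∎
        where
        open ≤-Reasoning
        split-off : ∀ s e → ⟦ s ⟧ ≤ ⟦ s ∧ not e ⟧ + ⟦ e ⟧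
        split-off false e     = z≤n
        split-off true  true  = ≤-refl
        split-off true  false = ≤-refl

      -- Every u_j counted by c(u_i) + 1 is an outsider or one of the three elements of S_l.
      co≤ : co n p S i ≤ outsiders + 2
      co≤ = +-cancelʳ-≤ 1 _ _ (begin
        co n p S i + 1                                      ≡⟨ co-as-∑ i ⟩
        _                                                   ≤⟨ ∑-mono classify (allFin N) ⟩
        ∑[ j ← allFin N ] (⟦ outsider j ⟧ + ⟦ inS l j ⟧)    ≡⟨ ∑-+ _ _ (allFin N) ⟩
        outsiders + ∑[ j ← allFin N ] ⟦ inS l j ⟧           ≡⟨ cong (outsiders +_) (∑-inS l) ⟩
        outsiders + 3                                       ≡⟨ +-assoc outsiders 2 1 ⟨
        outsiders + 2 + 1                                   ∎)
        where
        open ≤-Reasoning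
        classify : ∀ j → ⟦ not (does (j ≟ i)) ∧ share n p S i j ⟧ + ⟦ does (j ≟ i) ⟧ ≤ ⟦ outsider j ⟧ + ⟦ inS l j ⟧
        classify j with j ≟ i
        ... | yes refl rewrite i∈ = ≤-refl
        ... | no _ = sharing (inS l j) (share n p S i j)
          where
          sharing : ∀ t sh → ⟦ sh ⟧ + 0 ≤ ⟦ not t ∧ sh ⟧ + ⟦ t ⟧
          sharing true  true  = ≤-refl
          sharing true  false = z≤n
          sharing false sh    = ≤-refl

      pair : V₂ n p m → ℕ
      pair w = err (x i) w + err (xS l) w

      same : cx i ≡ cxS l
      same = sym joined

      -- If y_j with u_j ∈ S_l is outside the cluster, both its '+' edges to the pair err; moreover
      -- each outsider y_j' gets '+' from x_i and '-' from x(S_l).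
      y-cost : ∀ j → inS l j ≡ true → cy j ≢ cxS l → outsiders + 2 ≤ ∑y pair
      y-cost j j∈ y≁x = begin
        outsiders + 2
          ≡⟨ cong (outsiders +_) (trans (∑-*ˡ 2 _ (allFin N)) (cong (2 *_) (∑-≟ j))) ⟨
        outsiders + ∑[ j' ← allFin N ] (2 * ⟦ does (j' ≟ j) ⟧)               ≡⟨ ∑-+ _ _ (allFin N) ⟨
        ∑[ j' ← allFin N ] (⟦ outsider j' ⟧ + 2 * ⟦ does (j' ≟ j) ⟧)          ≤⟨ ∑-mono at-y' (allFin N) ⟩
        ∑y pair                                                              ∎
        where
        open ≤-Reasoning
        at-y : 2 ≤ pair (y j)
        at-y = +-mono-≤ (outside-error (x i) (y j) sign-x (λ e → y≁x (trans (sym e) same)))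
                        (outside-error (xS l) (y j) j∈ (λ e → y≁x (sym e)))
          where
          sign-x : does (i ≟ j) ∨ share n p S i j ≡ true
          sign-x = trans (cong (does (i ≟ j) ∨_) (share-intro l i j i∈ j∈)) (∨-zeroʳ _)
        at-y' : ∀ j' → ⟦ outsider j' ⟧ + 2 * ⟦ does (j' ≟ j) ⟧ ≤ pair (y j')
        at-y' j' with j' ≟ j
        ... | yes refl = subst (λ t → ⟦ not t ∧ (not (does (j ≟ i)) ∧ share n p S i j) ⟧ + 2 * 1 ≤ pair (y j))
                               (sym j∈) at-y
        ... | no _ = ≤-trans (outsider-signs (inS l j') (does (j' ≟ i)) (does (i ≟ j')) (share n p S i j'))
                             (disagree (x i) (xS l) (y j') same)
          where
          outsider-signs : ∀ t d d' sh → ⟦ not t ∧ (not d ∧ sh) ⟧ + 0 ≤ ⟦ (d' ∨ sh) xor t ⟧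
          outsider-signs true  d     d'    sh    = z≤n
          outsider-signs false true  d'    sh    = z≤n
          outsider-signs false false d'    false = z≤n
          outsider-signs false false true  true  = ≤-refl
          outsider-signs false false false true  = ≤-refl

      -- For S_l' ∋ u_i with l' ≠ l, every y_k(S_l') gets '+' from x_i and '-' from x(S_l).
      yS-cost : m * others ≤ ∑yS pair
      yS-cost = begin
        m * others                                         ≡⟨ ∑-*ˡ m _ (allFin p) ⟨
        ∑[ l' ← allFin p ] (m * ⟦ other l' ⟧)             ≡⟨ ∑-cong (λ l' → ∑-allFin-const m _) (allFin p) ⟨
        ∑[ l' ← allFin p ] ∑[ _ ← allFin m ] ⟦ other l' ⟧ ≤⟨ ∑-mono (λ l' → ∑-mono (at-yS l') (allFin m)) (allFin p) ⟩
        ∑yS pair                                           ∎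
        where
        open ≤-Reasoning
        at-yS : ∀ l' k → ⟦ other l' ⟧ ≤ pair (yS l' k)
        at-yS l' k = ≤-trans (subst (λ e → ⟦ other l' ⟧ ≤ ⟦ inS l' i xor e ⟧) (≟-sym l' l)
                                    (∧-not≤xor (inS l' i) (does (l' ≟ l))))
                             (disagree (x i) (xS l) (yS l' k) same)

      -- Every z_j gets '+' from x_i and '-' from x(S_l).
      z-cost : N ≤ ∑z pair
      z-cost = begin
        N                        ≡⟨ trans (∑-allFin-const N 1) (*-identityʳ N) ⟨
        ∑[ _ ← allFin N ] 1      ≤⟨ ∑-mono (λ j → disagree (x i) (xS l) (z j) same) (allFin N) ⟩
        ∑z pair                  ∎
        where open ≤-Reasoning

    -- If x_i joins x(S_l) with u_i ∈ S_l, then every y_j with u_j ∈ S_l is in that cluster too: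
    -- otherwise the pair x_i, x(S_l) errs more than their combined tolerances allow.
    joins-closed : ∀ i l j → JoinsOwnSet i l → inS l j ≡ true → cy j ≡ cxS l
    joins-closed i l j (i∈ , joined) j∈ with cy j ℕ.≟ cxS l
    ... | yes y~x = y~x
    ... | no  y≁x = ⊥-elim (m+1+n≰m (E + m + 3) (begin
      E + m + 3 + 2                                  ≡⟨ rearrange₁ E m ⟩
      E + (m + 5)                                    ≤⟨ ground-errors i ⟩
      m * deg n p S i + co n p S i + N               ≤⟨ +-monoˡ-≤ N (+-mono-≤ deg≤ co≤) ⟩
      (m * others + m) + (outsiders + 2) + N         ≡⟨ rearrange₂ (m * others) m outsiders N ⟩
      outsiders + 2 + (m * others + N) + m           ≤⟨ +-monoˡ-≤ m pair-cost ⟩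
      E + errors n p m S cl (xS l) + m               ≤⟨ +-monoˡ-≤ m (+-monoʳ-≤ E (triplet-errors l)) ⟩
      E + 3 + m                                      ≡⟨ rearrange₃ E m ⟩
      E + m + 3                                      ∎))
      where
      open ≤-Reasoning
      open Joined i l i∈ joined
      E = errors n p m S cl (x i)
      pair-cost : outsiders + 2 + (m * others + N) ≤ E + errors n p m S cl (xS l)
      pair-cost = begin
        outsiders + 2 + (m * others + N)      ≤⟨ +-mono-≤ (y-cost j j∈ y≁x) (+-mono-≤ yS-cost z-cost) ⟩
        ∑y pair + (∑yS pair + ∑z pair)        ≡⟨ errors-pair (x i) (xS l) ⟨
        E + errors n p m S cl (xS l)          ∎
      rearrange₁ : ∀ E m → E + m + 3 + 2 ≡ E + (m + 5)
      rearrange₁ = solve-∀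
      rearrange₂ : ∀ a m T N → a + m + (T + 2) + N ≡ T + 2 + (a + N) + m
      rearrange₂ = solve-∀
      rearrange₃ : ∀ E m → E + 3 + m ≡ E + m + 3
      rearrange₃ = solve-∀

    chosen : Subset p
    chosen = Vec.tabulate (λ l → does (any? (λ i → joins? i l)))

    chosen⇒ : ∀ {l} → l ∈ chosen → ∃ λ i → JoinsOwnSet i l
    chosen⇒ {l} l∈ = does⇒ (any? (λ i → joins? i l)) (trans (sym (lookup∘tabulate _ l)) ([]=⇒lookup l∈))

    ⇒chosen : ∀ {i l} → JoinsOwnSet i l → l ∈ chosen
    ⇒chosen {i} {l} joins = lookup⇒[]= l chosen
      (trans (lookup∘tabulate _ l) (dec-true (any? (λ i → joins? i l)) (i , joins)))

    -- A chosen set S_l containing u_i is the set joined by x_i: both triplet vertices share the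
    -- cluster of y_i, so they coincide.
    chosen-unique : ∀ i l → l ∈ chosen → inS l i ≡ true → l ≡ proj₁ (ground-joins i)
    chosen-unique i l l∈ i∈ with chosen⇒ l∈ | ground-joins i
    ... | (i' , joins') | (l₀ , joins₀) = triplets-separated l l₀
      (trans (sym (joins-closed i' l i joins' i∈)) (joins-closed i l₀ i joins₀ (proj₁ joins₀)))

    exact-cover : HasExactCover n p S
    exact-cover = chosen , λ i →
      proj₁ (ground-joins i) , ⇒chosen (proj₂ (ground-joins i)) , inS⇒∈ (proj₁ (proj₂ (ground-joins i))) ,
      λ l l∈ i∈ → chosen-unique i l l∈ (∈⇒inS i∈)

corollary2 : (n p m : ℕ) → 1 ≤ n → 1 ≤ p → 6 * n + 3 * p ≤ m →
    (S : Family n p) → ((j : _) → ∣ S j ∣ ≡ 3) → Injective _≡_ _≡_ S →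
    (HasOneSidedPerfectClustering n p m S ⇔ HasExactCover n p S)
corollary2 n p m n≥1 p≥1 m-large S triples _ = mk⇔
  (λ (cl , perfect) → ToCover.exact-cover nine large cl perfect)
  (λ cover → FromCover.clustering (coverMap cover) , FromCover.perfect (coverMap cover))
  where
  open Construction n p m S triples
  nine : 9 ≤ m
  nine = ≤-trans (+-mono-≤ (*-monoʳ-≤ 6 n≥1) (*-monoʳ-≤ 3 p≥1)) m-large
  large : N + N + 3 * p ≤ m
  large = subst (_≤ m) (split-six n p) m-large
    where
    split-six : ∀ n p → 6 * n + 3 * p ≡ 3 * n + 3 * n + 3 * p
    split-six = solve-∀
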